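{- For $n\ge 0$, let $a(n)$ be the number of compositions of $n$ that avoid each of the three compositions $252$, $343$, $424$ (i.e. $2,5,2$; $3,4,3$; $4,2,4$). Then $$ \sum_{n=0}^{\infty} a(n)\, x^n = -\frac{x^{17}+3x^{14}+x^{13}-3x^{11}+x^{10}+x^{6}-x^{5}+x^{4}+x^{2}-2x+1}{x^{18}+3x^{15}+2x^{14}-2x^{13}-2x^{12}+3x^{11}-3x^{10}+x^{8}+x^{7}-x^{6}+2x^{5}-x^{4}-2x^{2}+3x-1} $$ as formal power series.
   Context: A composition of a non-negative integer $n$ is an ordered list $a_1 a_2 \dots a_k$ ($k\ge 0$) of positive integers with $a_1+\dots+a_k=n$; the empty composition is the unique composition of $0$. A composition $a_1\dots a_k$ includes (contains) the composition $b_1\dots b_s$ if $k \ge s$ and there is an index $i$ with $1\le i\le k-s+1$ such that $b_1\le a_i,\ b_2\le a_{i+1},\ \dots,\ b_s\le a_{i+s-1}$. It avoids $b_1\dots b_s$ if it does not include it; it avoids a set of compositions if it avoids every member of the set. -}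

module Defs where

open import Data.Nat using (ℕ; zero; suc; _≤_; _≤?_; _∸_)
open import Data.Integer as ℤ using (ℤ; +_; -_)
open import Data.List using (List; []; _∷_; map; concatMap; length; filter; upTo; tails)
open import Data.List.Relation.Unary.All using (All)
open import Data.List.Relation.Unary.Any using (Any; any?)
open import Data.Product using (_×_)
open import Data.Unit using (⊤)
open import Data.Empty using (⊥)
open import Data.Nat.ListAction using (sum)
open import Relation.Nullary using (Dec; yes; no; ¬_; ¬?)
open import Relation.Nullary.Decidable using (_×-dec_)
open import Relation.Binary.PropositionalEquality using (_≡_)
import Data.Nat as ℕ

IsComposition : ℕ → List ℕ → Set
IsComposition n as = All (λ a → 1 ≤ a) as × sum as ≡ n

_≤ₚ_ : List ℕ → List ℕ → Set
[] ≤ₚ as = ⊤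
(b ∷ bs) ≤ₚ [] = ⊥
(b ∷ bs) ≤ₚ (a ∷ as) = (b ≤ a) × (bs ≤ₚ as)

_≤ₚ?_ : (bs as : List ℕ) → Dec (bs ≤ₚ as)
[] ≤ₚ? as = yes _
(b ∷ bs) ≤ₚ? [] = no (λ ())
(b ∷ bs) ≤ₚ? (a ∷ as) = (b ≤? a) ×-dec (bs ≤ₚ? as)

Includes : List ℕ → List ℕ → Set
Includes as bs = Any (λ t → bs ≤ₚ t) (tails as)

includes? : (as bs : List ℕ) → Dec (Includes as bs)
includes? as bs = any? (λ t → bs ≤ₚ? t) (tails as)

Avoids : List ℕ → List (List ℕ) → Set
Avoids as P = All (λ b → ¬ Includes as b) P

avoids? : (as : List ℕ) → (P : List (List ℕ)) → Dec (Avoids as P)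
avoids? as P = Data.List.Relation.Unary.All.all? (λ b → ¬? (includes? as b)) P

listsOf : ℕ → ℕ → List (List ℕ)
listsOf zero m = [] ∷ []
listsOf (suc len) m = concatMap (λ a → map (suc a ∷_) (listsOf len m)) (upTo m)

-- All lists of length ≤ n with entries in {1,…,n} (pairwise distinct);
-- every composition of n occurs in this list exactly once.
candidates : ℕ → List (List ℕ)
candidates n = concatMap (λ len → listsOf len n) (upTo (suc n))

isComposition? : (n : ℕ) → (as : List ℕ) → Dec (IsComposition n as)
isComposition? n as =
  Data.List.Relation.Unary.All.all? (λ a → 1 ≤? a) as ×-dec (sum as ℕ.≟ n)

countAvoiders : List (List ℕ) → ℕ → ℕ
countAvoiders P n =
  length (filter (λ as → avoids? as P) (filter (isComposition? n) (candidates n)))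

patterns : List (List ℕ)
patterns = (2 ∷ 5 ∷ 2 ∷ []) ∷ (3 ∷ 4 ∷ 3 ∷ []) ∷ (4 ∷ 2 ∷ 4 ∷ []) ∷ []

a : ℕ → ℕ
a = countAvoiders patterns

-- Formal power series over ℤ as coefficient sequences; polynomials as
-- coefficient lists (constant term first).
coeff : List ℤ → ℕ → ℤ
coeff [] k = + 0
coeff (c ∷ cs) zero = c
coeff (c ∷ cs) (suc k) = coeff cs k

Σ≤ : ℕ → (ℕ → ℤ) → ℤ
Σ≤ zero f = f 0
Σ≤ (suc n) f = Σ≤ n f ℤ.+ f (suc n)

mulCoeff : (ℕ → ℤ) → List ℤ → ℕ → ℤ
mulCoeff s p n = Σ≤ n (λ k → coeff p k ℤ.* s (n ∸ k))

numer : List ℤ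
numer = + 1 ∷ - (+ 2) ∷ + 1 ∷ + 0 ∷ + 1 ∷ - (+ 1) ∷ + 1 ∷ + 0 ∷ + 0 ∷ + 0 ∷
        + 1 ∷ - (+ 3) ∷ + 0 ∷ + 1 ∷ + 3 ∷ + 0 ∷ + 0 ∷ + 1 ∷ []

denom : List ℤ
denom = - (+ 1) ∷ + 3 ∷ - (+ 2) ∷ + 0 ∷ - (+ 1) ∷ + 2 ∷ - (+ 1) ∷ + 1 ∷ + 1 ∷ + 0 ∷
        - (+ 3) ∷ + 3 ∷ - (+ 2) ∷ - (+ 2) ∷ + 2 ∷ + 3 ∷ + 0 ∷ + 0 ∷ + 1 ∷ []

-- A composition avoids 252, 343 and 424 iff it is accepted by an eight-state automaton reading
-- each part clamped to [1, 5].  Splitting off the first part expresses the number H (5 + n) q of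
-- compositions of 5 + n accepted from state q through H (n + i) for 1 ≤ i ≤ 4 and the partial sum
-- H≤ n, since all parts ≥ 5 act alike; so the vector v n of the values H (n + i) q (i < 5) and
-- H≤ n q satisfies v (n + 1) = M v n for a 48 × 48 transfer matrix M.  As a n = e₀ · v n, the
-- coefficient of x^(18 + m) in (Σ a(n) xⁿ) · denom is w · v m for w = Σₖ denomₖ e₀ M^(18 − k).
-- This w is not zero, but w, w M, …, w M⁵ are orthogonal to v 0 and w M⁶ = 2 w M⁵, so w · v m = 0
-- for all m; the coefficients below x¹⁸ are computed directly.
module Submission where

open import Defs

open import Data.Bool using (Bool; true; false; not; _∧_; _∨_; if_then_else_)
import Data.Bool.Properties as Bool
open import Data.Fin using (Fin; zero; suc; toℕ; #_; _≟_)
open import Data.Fin.Properties using (all?; toℕ<n)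
open import Data.List using (List; []; _∷_; _++_; map; concat; concatMap; tabulate; filter; length; applyUpTo)
open import Data.List.Properties using (tabulate-cong; map-tabulate; concat-map; ≡-dec)
open import Data.List.Relation.Unary.All as All using (All; []; _∷_)
open import Data.List.Relation.Unary.Any using (any?; here; there)
open import Data.Nat as ℕ using (ℕ; zero; suc; _+_; _*_; _∸_; _≤_; _<_; _≤?_; _≤ᵇ_; z≤n; s≤s)
import Data.Nat.Properties as ℕ
open import Data.Nat.Properties
  using (≤-refl; ≤-reflexive; ≤-trans; n≤1+n; m≤n⇒m≤1+n; <⇒≱; ≮⇒≥; ≤⇒≤ᵇ; m≤m+n; m≤n+m; m∸n≤m;
         +-assoc; +-identityʳ; m+n∸m≡n; m+[n∸m]≡n; +-∸-comm; allUpTo?)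
open import Data.Nat.ListAction using (sum)
open import Data.Product using (_×_; _,_)
open import Function using (_∘_)
open import Function.Bundles using (mk⇔; Equivalence)
open import Relation.Nullary using (Dec; yes; no; does; ¬_)
open import Relation.Nullary.Decidable using (dec-true; dec-false; does-⇔; toWitness; _×-dec_)
open import Relation.Binary.PropositionalEquality
  using (_≡_; refl; sym; trans; cong; cong₂; subst; module ≡-Reasoning)
open import Algebra.Properties.CommutativeSemigroup ℕ.+-commutativeSemigroup
  using () renaming (interchange to +-interchange)

open ≡-Reasoning

private
  variable
    A B : Set

∑< : ℕ → (ℕ → ℕ) → ℕ
∑< zero    f = 0
∑< (suc k) f = f 0 + ∑< k (f ∘ suc)

∑<-cong : ∀ k {f g : ℕ → ℕ} → (∀ {i} → i < k → f i ≡ g i) → ∑< k f ≡ ∑< k g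
∑<-cong zero    eq = refl
∑<-cong (suc k) eq = cong₂ _+_ (eq (s≤s z≤n)) (∑<-cong k (eq ∘ s≤s))

∑<-zero : ∀ k {f : ℕ → ℕ} → (∀ i → f i ≡ 0) → ∑< k f ≡ 0
∑<-zero zero    eq = refl
∑<-zero (suc k) eq = cong₂ _+_ (eq 0) (∑<-zero k (eq ∘ suc))

∑<-+ : ∀ k (f g : ℕ → ℕ) → ∑< k (λ i → f i + g i) ≡ ∑< k f + ∑< k g
∑<-+ zero    f g = refl
∑<-+ (suc k) f g = trans (cong (f 0 + g 0 +_) (∑<-+ k (f ∘ suc) (g ∘ suc)))
                         (+-interchange (f 0) (g 0) (∑< k (f ∘ suc)) (∑< k (g ∘ suc)))

∑<-comm : ∀ k m (F : ℕ → ℕ → ℕ) → ∑< k (λ i → ∑< m (F i)) ≡ ∑< m (λ j → ∑< k (λ i → F i j))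
∑<-comm zero    m F = sym (∑<-zero m (λ _ → refl))
∑<-comm (suc k) m F = trans (cong (∑< m (F 0) +_) (∑<-comm k m (F ∘ suc)))
                            (sym (∑<-+ m (F 0) (λ j → ∑< k (λ i → F (suc i) j))))

∑<-truncate : ∀ k m {f : ℕ → ℕ} → k ≤ m → (∀ {i} → k ≤ i → f i ≡ 0) → ∑< m f ≡ ∑< k f
∑<-truncate zero    m       k≤m       eq = ∑<-zero m (λ i → eq z≤n)
∑<-truncate (suc k) (suc m) (s≤s k≤m) eq = cong (_ +_) (∑<-truncate k m k≤m (eq ∘ s≤s))

𝟙 : Bool → ℕ
𝟙 true  = 1
𝟙 false = 0

count : (A → Bool) → List A → ℕ
count p []       = 0
count p (x ∷ xs) = 𝟙 (p x) + count p xs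

module _ {P : A → Set} (P? : ∀ x → Dec (P x)) where

  length-filter : ∀ xs → length (filter P? xs) ≡ count (does ∘ P?) xs
  length-filter []       = refl
  length-filter (x ∷ xs) with does (P? x)
  ... | true  = cong suc (length-filter xs)
  ... | false = length-filter xs

  count-filter : ∀ (p : A → Bool) xs → count p (filter P? xs) ≡ count (λ x → does (P? x) ∧ p x) xs
  count-filter p []       = refl
  count-filter p (x ∷ xs) with does (P? x)
  ... | true  = cong (𝟙 (p x) +_) (count-filter p xs)
  ... | false = count-filter p xs

count-++ : ∀ (p : A → Bool) xs ys → count p (xs ++ ys) ≡ count p xs + count p ys
count-++ p []       ys = refl
count-++ p (x ∷ xs) ys = trans (cong (𝟙 (p x) +_) (count-++ p xs ys)) (sym (+-assoc (𝟙 (p x)) _ _))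

count-map : ∀ (p : B → Bool) (f : A → B) xs → count p (map f xs) ≡ count (p ∘ f) xs
count-map p f []       = refl
count-map p f (x ∷ xs) = cong (𝟙 (p (f x)) +_) (count-map p f xs)

count-cong : ∀ {p q : A → Bool} → (∀ x → p x ≡ q x) → ∀ xs → count p xs ≡ count q xs
count-cong eq []       = refl
count-cong eq (x ∷ xs) = cong₂ _+_ (cong 𝟙 (eq x)) (count-cong eq xs)

count-false : ∀ (xs : List A) → count (λ _ → false) xs ≡ 0
count-false []       = refl
count-false (x ∷ xs) = count-false xs

count-concatMap : ∀ (p : B → Bool) (f : A → List B) (h : ℕ → A) k →
                  count p (concatMap f (applyUpTo h k)) ≡ ∑< k (λ i → count p (f (h i)))
count-concatMap p f h zero    = refl
count-concatMap p f h (suc k) =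
  trans (count-++ p (f (h 0)) _) (cong (count p (f (h 0)) +_) (count-concatMap p f (h ∘ suc) k))

-- Compositions counted by their first part

isComp : ℕ → List ℕ → Bool
isComp n as = does (isComposition? n as)

isComp-∷ : ∀ {n a} as → suc a ≤ n → isComp n (suc a ∷ as) ≡ isComp (n ∸ suc a) as
isComp-∷ {n} {a} as a<n =
  does-⇔ (mk⇔ peel glue) (isComposition? n (suc a ∷ as)) (isComposition? (n ∸ suc a) as)
  where
  peel : IsComposition n (suc a ∷ as) → IsComposition (n ∸ suc a) as
  peel (_ ∷ parts , sum≡) = parts , trans (sym (m+n∸m≡n (suc a) _)) (cong (_∸ suc a) sum≡)
  glue : IsComposition (n ∸ suc a) as → IsComposition n (suc a ∷ as)
  glue (parts , sum≡) = s≤s z≤n ∷ parts , trans (cong (suc a +_) sum≡) (m+[n∸m]≡n a<n)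

isComp-∷-large : ∀ {n a} as → ¬ (suc a ≤ n) → isComp n (suc a ∷ as) ≡ false
isComp-∷-large {n} {a} as a≮n =
  dec-false (isComposition? n (suc a ∷ as)) λ (_ , sum≡) →
    a≮n (≤-trans (m≤m+n (suc a) (sum as)) (≤-reflexive sum≡))

-- Counts by the first part 1 + a; F is fuel, irrelevant as soon as F > n (#compositions-fuel).
#compositions : ℕ → ℕ → (List ℕ → Bool) → ℕ
#compositions zero    n       g = 0
#compositions (suc F) zero    g = 𝟙 (g [])
#compositions (suc F) (suc n) g = ∑< (suc n) λ a → #compositions F (n ∸ a) (g ∘ (suc a ∷_))

#compositions-fuel : ∀ F F' n g → n < F → n < F' → #compositions F n g ≡ #compositions F' n g
#compositions-fuel (suc F) (suc F') zero    g _         _          = refl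
#compositions-fuel (suc F) (suc F') (suc n) g (s≤s n<F) (s≤s n<F') = ∑<-cong (suc n) λ {a} _ →
  #compositions-fuel F F' (n ∸ a) (g ∘ (suc a ∷_))
    (≤-trans (s≤s (m∸n≤m n a)) n<F) (≤-trans (s≤s (m∸n≤m n a)) n<F')

#compositions-cong : ∀ F n {g h : List ℕ → Bool} → (∀ as → g as ≡ h as) →
                     #compositions F n g ≡ #compositions F n h
#compositions-cong zero    n       eq = refl
#compositions-cong (suc F) zero    eq = cong 𝟙 (eq [])
#compositions-cong (suc F) (suc n) eq =
  ∑<-cong (suc n) λ {a} _ → #compositions-cong F (n ∸ a) (eq ∘ (suc a ∷_))

count-listsOf-suc : ∀ (p : List ℕ → Bool) len m →
                    count p (listsOf (suc len) m) ≡ ∑< m (λ a → count (p ∘ (suc a ∷_)) (listsOf len m))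
count-listsOf-suc p len m =
  trans (count-concatMap p (λ a → map (suc a ∷_) (listsOf len m)) (λ a → a) m)
        (∑<-cong m λ {a} _ → count-map p (suc a ∷_) (listsOf len m))

count-listsOf : ∀ F L m n g → n < F → n ≤ m → n ≤ L →
  ∑< (suc L) (λ len → count (λ as → isComp n as ∧ g as) (listsOf len m)) ≡ #compositions F n g
count-listsOf (suc F) L m zero g _ _ _ = begin
  𝟙 (g []) + 0 + ∑< L (λ len → count p (listsOf (suc len) m))
    ≡⟨ cong (𝟙 (g []) + 0 +_) (∑<-zero L λ len → trans (count-listsOf-suc p len m) (∑<-zero m λ a →
         trans (count-cong (λ as → cong (_∧ g (suc a ∷ as)) (isComp-∷-large {0} {a} as λ ())) (listsOf len m))
               (count-false (listsOf len m)))) ⟩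
  𝟙 (g []) + 0 + 0
    ≡⟨ trans (+-identityʳ _) (+-identityʳ _) ⟩
  𝟙 (g []) ∎
  where p = λ as → isComp 0 as ∧ g as
count-listsOf (suc F) (suc L) m (suc n) g (s≤s n<F) n<m (s≤s n≤L) = begin
  ∑< (suc L) (λ len → count p (listsOf (suc len) m))
    ≡⟨ ∑<-cong (suc L) (λ {len} _ → count-listsOf-suc p len m) ⟩
  ∑< (suc L) (λ len → ∑< m (λ a → count (p ∘ (suc a ∷_)) (listsOf len m)))
    ≡⟨ ∑<-comm (suc L) m (λ len a → count (p ∘ (suc a ∷_)) (listsOf len m)) ⟩
  ∑< m (λ a → ∑< (suc L) (λ len → count (p ∘ (suc a ∷_)) (listsOf len m)))
    ≡⟨ ∑<-truncate (suc n) m n<m (λ {a} n<a → ∑<-zero (suc L) λ len →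
         trans (count-cong (λ as → cong (_∧ g (suc a ∷ as)) (isComp-∷-large as (<⇒≱ (s≤s n<a))))
                           (listsOf len m))
               (count-false (listsOf len m))) ⟩
  ∑< (suc n) (λ a → ∑< (suc L) (λ len → count (p ∘ (suc a ∷_)) (listsOf len m)))
    ≡⟨ ∑<-cong (suc n) (λ {a} a≤n → trans
         (∑<-cong (suc L) λ {len} _ →
            count-cong (λ as → cong (_∧ g (suc a ∷ as)) (isComp-∷ as a≤n)) (listsOf len m))
         (count-listsOf F L m (n ∸ a) (g ∘ (suc a ∷_)) (≤-trans (s≤s (m∸n≤m n a)) n<F)
           (≤-trans (m∸n≤m n a) (≤-trans (n≤1+n n) n<m)) (≤-trans (m∸n≤m n a) n≤L))) ⟩
  #compositions (suc F) (suc n) g ∎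
  where p = λ as → isComp (suc n) as ∧ g as

avoidsᵇ : List (List ℕ) → List ℕ → Bool
avoidsᵇ P as = does (avoids? as P)

countAvoiders-#compositions : ∀ P n → countAvoiders P n ≡ #compositions (suc n) n (avoidsᵇ P)
countAvoiders-#compositions P n = begin
  length (filter avoids?P (filter (isComposition? n) (candidates n)))
    ≡⟨ length-filter avoids?P (filter (isComposition? n) (candidates n)) ⟩
  count (does ∘ avoids?P) (filter (isComposition? n) (candidates n))
    ≡⟨ count-filter (isComposition? n) (does ∘ avoids?P) (candidates n) ⟩
  count (λ as → isComp n as ∧ does (avoids?P as)) (candidates n)
    ≡⟨ count-concatMap _ (λ len → listsOf len n) (λ len → len) (suc n) ⟩
  ∑< (suc n) (λ len → count (λ as → isComp n as ∧ does (avoids?P as)) (listsOf len n))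
    ≡⟨ count-listsOf (suc n) n n n (does ∘ avoids?P) ≤-refl ≤-refl ≤-refl ⟩
  #compositions (suc n) n (does ∘ avoids?P) ∎
  where avoids?P = λ as → avoids? as P

occursAtStart : List (List ℕ) → List ℕ → Bool
occursAtStart P as = does (any? (_≤ₚ? as) P)

not-∨-∧-exchange : ∀ a b c d → not (a ∨ b) ∧ (not c ∧ d) ≡ not (a ∨ c) ∧ (not b ∧ d)
not-∨-∧-exchange true  b     c     d = refl
not-∨-∧-exchange false true  true  d = refl
not-∨-∧-exchange false true  false d = refl
not-∨-∧-exchange false false true  d = refl
not-∨-∧-exchange false false false d = refl

avoids-∷ : ∀ P x xs → avoidsᵇ P (x ∷ xs) ≡ not (occursAtStart P (x ∷ xs)) ∧ avoidsᵇ P xs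
avoids-∷ []      x xs = refl
avoids-∷ (b ∷ P) x xs =
  trans (cong (not (does (b ≤ₚ? (x ∷ xs)) ∨ does (includes? xs b)) ∧_) (avoids-∷ P x xs))
        (not-∨-∧-exchange (does (b ≤ₚ? (x ∷ xs))) (does (includes? xs b))
                          (occursAtStart P (x ∷ xs)) (avoidsᵇ P xs))

≤ₚ⇒length≤ : ∀ bs as → bs ≤ₚ as → length bs ≤ length as
≤ₚ⇒length≤ []       as       _         = z≤n
≤ₚ⇒length≤ (b ∷ bs) (a ∷ as) (_ , bs≤) = s≤s (≤ₚ⇒length≤ bs as bs≤)

includes⇒length≤ : ∀ as {bs} → Includes as bs → length bs ≤ length as
includes⇒length≤ as       (here bs≤)  = ≤ₚ⇒length≤ _ as bs≤
includes⇒length≤ (x ∷ as) (there inc) = m≤n⇒m≤1+n (includes⇒length≤ as inc)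

¬includes-longer : ∀ as {bs} → length as < length bs → ¬ Includes as bs
¬includes-longer as as<bs inc = <⇒≱ as<bs (includes⇒length≤ as inc)

avoids-short : ∀ as → length as < 3 → avoidsᵇ patterns as ≡ true
avoids-short as as<3 =
  dec-true (avoids? as patterns) (longer ∷ longer ∷ longer ∷ [])
  where
  longer : ∀ {b c d} → ¬ Includes as (b ∷ c ∷ d ∷ [])
  longer = ¬includes-longer as as<3

-- The automaton

-- Parts are only ever compared with the pattern entries 2, …, 5, so a part matters only through
-- its value clamped to [1, 5]; the class c ∈ Fin 5 stands for the part 1 + c.
Class : Set
Class = Fin 5

pattern c1 = zero
pattern c2 = suc zero
pattern c3 = suc (suc zero)
pattern c4 = suc (suc (suc zero))
pattern c5 = suc (suc (suc (suc zero)))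

class : ℕ → Class
class 0 = c1
class 1 = c1
class 2 = c2
class 3 = c3
class 4 = c4
class (suc (suc (suc (suc (suc _))))) = c5

value : Class → ℕ
value c = suc (toℕ c)

≤ᵇ-class : ∀ {k} → 2 ≤ k → k ≤ 5 → ∀ x → (k ≤ᵇ x) ≡ (k ≤ᵇ value (class x))
≤ᵇ-class (s≤s (s≤s _)) _ 0 = refl
≤ᵇ-class _ _ 1 = refl
≤ᵇ-class _ _ 2 = refl
≤ᵇ-class _ _ 3 = refl
≤ᵇ-class _ _ 4 = refl
≤ᵇ-class _ k≤5 (suc (suc (suc (suc (suc y))))) =
  trans (≤ᵇ-true (≤-trans k≤5 (m≤m+n 5 y))) (sym (≤ᵇ-true k≤5))
  where
  ≤ᵇ-true : ∀ {m n} → m ≤ n → (m ≤ᵇ n) ≡ true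
  ≤ᵇ-true = Equivalence.to Bool.T-≡ ∘ ≤⇒≤ᵇ

InRange : ℕ → Set
InRange k = 2 ≤ k × k ≤ 5

≤ₚ-class : ∀ {bs} → All InRange bs → ∀ xs → does (bs ≤ₚ? xs) ≡ does (bs ≤ₚ? map (value ∘ class) xs)
≤ₚ-class []                  xs       = refl
≤ₚ-class (_ ∷ _)             []       = refl
≤ₚ-class ((2≤k , k≤5) ∷ ks) (x ∷ xs) = cong₂ _∧_ (≤ᵇ-class 2≤k k≤5 x) (≤ₚ-class ks xs)

occursAtStart-class : ∀ {P} → All (All InRange) P → ∀ xs →
                      occursAtStart P xs ≡ occursAtStart P (map (value ∘ class) xs)
occursAtStart-class []       xs = refl
occursAtStart-class (b ∷ bs) xs = cong₂ _∨_ (≤ₚ-class b xs) (occursAtStart-class bs xs)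

patterns-inRange : All (All InRange) patterns
patterns-inRange = toWitness {a? = All.all? (All.all? λ k → (2 ≤? k) ×-dec (k ≤? 5)) patterns} _

-- A state records what the last two parts threaten: in killsₖ the next part completes a forbidden
-- window iff it is ≥ k (reached after ≥ 4 then 2 or 3, after ≥ 3 then 4, after ≥ 2 then ≥ 5);
-- start, last2, last3 and last≥4 threaten nothing.
State : Set
State = Fin 8

pattern start  = zero
pattern last2  = suc zero
pattern last3  = suc (suc zero)
pattern last≥4 = suc (suc (suc zero))
pattern kills₄ = suc (suc (suc (suc zero)))
pattern kills₃ = suc (suc (suc (suc (suc zero))))
pattern kills₂ = suc (suc (suc (suc (suc (suc zero)))))
pattern dead   = suc (suc (suc (suc (suc (suc (suc zero))))))

δ : State → Class → State
δ dead   _  = dead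
δ _      c1 = start
δ start  c2 = last2
δ start  c3 = last3
δ start  _  = last≥4
δ last2  c2 = last2
δ last2  c3 = last3
δ last2  c4 = last≥4
δ last2  c5 = kills₂
δ last3  c2 = last2
δ last3  c3 = last3
δ last3  c4 = kills₃
δ last3  c5 = kills₂
δ last≥4 c2 = kills₄
δ last≥4 c3 = kills₄
δ last≥4 c4 = kills₃
δ last≥4 c5 = kills₂
δ kills₄ c2 = last2
δ kills₄ c3 = last3
δ kills₄ _  = dead
δ kills₃ c2 = kills₄
δ kills₃ _  = dead
δ kills₂ _  = dead

run : State → List ℕ → State
run q []       = q
run q (x ∷ xs) = run (δ q (class x)) xs

alive : State → Bool
alive dead = false
alive _    = true

after₂ : Class → Class → State
after₂ c d = δ (δ start c) d

forbidden : Class → Class → Class → Bool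
forbidden c d e = occursAtStart patterns (value c ∷ value d ∷ value e ∷ [])

δ-after₂ : ∀ c d e → δ (after₂ c d) e ≡ (if forbidden c d e then dead else after₂ d e)
δ-after₂ = toWitness {a? = all? λ c → all? λ d → all? λ e →
                            δ (after₂ c d) e ≟ (if forbidden c d e then dead else after₂ d e)} _

alive-after₁ : ∀ c → alive (δ start c) ≡ true
alive-after₁ = toWitness {a? = all? λ c → alive (δ start c) Bool.≟ true} _

alive-after₂ : ∀ c d → alive (after₂ c d) ≡ true
alive-after₂ = toWitness {a? = all? λ c → all? λ d → alive (after₂ c d) Bool.≟ true} _

run-dead : ∀ xs → run dead xs ≡ dead
run-dead []       = refl
run-dead (x ∷ xs) = run-dead xs

alive-run-if : ∀ b q xs → alive (run (if b then dead else q) xs) ≡ not b ∧ alive (run q xs)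
alive-run-if true  q xs = cong alive (run-dead xs)
alive-run-if false q xs = refl

avoids-after₂ : ∀ x y xs →
                avoidsᵇ patterns (x ∷ y ∷ xs) ≡ alive (run (after₂ (class x) (class y)) xs)
avoids-after₂ x y []       =
  trans (avoids-short (x ∷ y ∷ []) ≤-refl) (sym (alive-after₂ (class x) (class y)))
avoids-after₂ x y (z ∷ xs) = begin
  avoidsᵇ patterns (x ∷ y ∷ z ∷ xs)
    ≡⟨ avoids-∷ patterns x (y ∷ z ∷ xs) ⟩
  not (occursAtStart patterns (x ∷ y ∷ z ∷ xs)) ∧ avoidsᵇ patterns (y ∷ z ∷ xs)
    ≡⟨ cong₂ (λ b c → not b ∧ c) (occursAtStart-class patterns-inRange (x ∷ y ∷ z ∷ xs))
                                 (avoids-after₂ y z xs) ⟩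
  not (forbidden (class x) (class y) (class z)) ∧ alive (run (after₂ (class y) (class z)) xs)
    ≡⟨ sym (alive-run-if (forbidden (class x) (class y) (class z)) _ xs) ⟩
  alive (run (if forbidden (class x) (class y) (class z) then dead else after₂ (class y) (class z)) xs)
    ≡⟨ cong (λ q → alive (run q xs)) (sym (δ-after₂ (class x) (class y) (class z))) ⟩
  alive (run (after₂ (class x) (class y)) (z ∷ xs)) ∎

avoids-run : ∀ as → avoidsᵇ patterns as ≡ alive (run start as)
avoids-run []           = refl
avoids-run (x ∷ [])     =
  trans (avoids-short (x ∷ []) (s≤s (s≤s z≤n))) (sym (alive-after₁ (class x)))
avoids-run (x ∷ y ∷ xs) = avoids-after₂ x y xs

-- Transfer equations

accepts : State → List ℕ → Bool
accepts q as = alive (run q as)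

H : ℕ → State → ℕ
H n q = #compositions (suc n) n (accepts q)

H≤ : ℕ → State → ℕ
H≤ n q = ∑< (suc n) λ a → H (n ∸ a) q

a≡H : ∀ n → a n ≡ H n start
a≡H n = trans (countAvoiders-#compositions patterns n) (#compositions-cong (suc n) n avoids-run)

H-fuel : ∀ {F n} q → n < F → #compositions F n (accepts q) ≡ H n q
H-fuel {F} {n} q n<F = #compositions-fuel F (suc n) n (accepts q) n<F ≤-refl

-- Split off the first part; all parts ≥ 5 lead to the same state.
H-recurrence : ∀ n q → H (5 + n) q ≡ H (4 + n) (δ q c1) + (H (3 + n) (δ q c2) + (H (2 + n) (δ q c3) +
                                     (H (1 + n) (δ q c4) + H≤ n (δ q c5))))
H-recurrence n q = cong (H (4 + n) (δ q c1) +_)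
  (cong₂ _+_ (H-fuel {n = 3 + n} (δ q c2) (m≤n+m _ 1))
  (cong₂ _+_ (H-fuel {n = 2 + n} (δ q c3) (m≤n+m _ 2))
  (cong₂ _+_ (H-fuel {n = 1 + n} (δ q c4) (m≤n+m _ 3))
             (∑<-cong (suc n) λ {i} _ → H-fuel {n = n ∸ i} (δ q c5) (≤-trans (s≤s (m∸n≤m n i)) (m≤n+m _ 4))))))

-- Sparse matrices and weight vectors

-- Opened only here: with +_ in scope, the sections (x +_) on ℕ above would be ambiguous.
open import Data.Integer as ℤ using (ℤ; +_; -_; 0ℤ)
import Data.Integer.Properties as ℤ
open import Algebra.Properties.CommutativeSemigroup ℤ.+-commutativeSemigroup
  using () renaming (interchange to ℤ+-interchange)

_!_ : List ℕ → ℕ → ℕ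
[]       ! j     = 0
(x ∷ xs) ! zero  = x
(x ∷ xs) ! suc j = xs ! j

!-++ˡ : ∀ xs {ys j} → j < length xs → (xs ++ ys) ! j ≡ xs ! j
!-++ˡ (x ∷ xs) {j = zero}  _         = refl
!-++ˡ (x ∷ xs) {j = suc j} (s≤s j<) = !-++ˡ xs j<

!-++ʳ : ∀ xs {ys} j → (xs ++ ys) ! (length xs + j) ≡ ys ! j
!-++ʳ []       j = refl
!-++ʳ (x ∷ xs) j = !-++ʳ xs j

!-concat-tabulate : ∀ {k b} (f : Fin k → List ℕ) → (∀ i → length (f i) ≡ b) →
                    ∀ i {j} → j < b → concat (tabulate f) ! (toℕ i * b + j) ≡ f i ! j
!-concat-tabulate f len zero    j<b = !-++ˡ (f zero) (subst (_ <_) (sym (len zero)) j<b)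
!-concat-tabulate {b = b} f len (suc i) {j} j<b = begin
  (f zero ++ rest) ! (b + toℕ i * b + j)
    ≡⟨ cong ((f zero ++ rest) !_) (trans (+-assoc b _ j) (cong (_+ (toℕ i * b + j)) (sym (len zero)))) ⟩
  (f zero ++ rest) ! (length (f zero) + (toℕ i * b + j))
    ≡⟨ !-++ʳ (f zero) (toℕ i * b + j) ⟩
  rest ! (toℕ i * b + j)
    ≡⟨ !-concat-tabulate (f ∘ suc) (len ∘ suc) i j<b ⟩
  f (suc i) ! j ∎
  where rest = concat (tabulate (f ∘ suc))

-- Row i of a sparse matrix lists the column indices j, with multiplicity M i j ∈ ℕ.
SparseMatrix : Set
SparseMatrix = List (List ℕ)

rowSum : List ℕ → List ℕ → ℕ
rowSum v row = sum (map (v !_) row)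

_·_ : SparseMatrix → List ℕ → List ℕ
M · v = map (rowSum v) M

_^_·_ : SparseMatrix → ℕ → List ℕ → List ℕ
M ^ zero  · v = v
M ^ suc k · v = M · (M ^ k · v)

-- Weights are row vectors acting on the left; missing entries count as zero.
⟨_,_⟩ : List ℤ → List ℕ → ℤ
⟨ w ∷ ws , x ∷ xs ⟩ = w ℤ.* + x ℤ.+ ⟨ ws , xs ⟩
⟨ _      , _      ⟩ = 0ℤ

infixl 6 _⊕_
_⊕_ : List ℤ → List ℤ → List ℤ
[]       ⊕ us       = us
(w ∷ ws) ⊕ []       = w ∷ ws
(w ∷ ws) ⊕ (u ∷ us) = w ℤ.+ u ∷ ws ⊕ us

infixr 7 _∙_
_∙_ : ℤ → List ℤ → List ℤ
c ∙ ws = map (c ℤ.*_) ws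

unit : ℕ → ℤ → List ℤ
unit zero    c = c ∷ []
unit (suc j) c = 0ℤ ∷ unit j c

spread : ℤ → List ℕ → List ℤ
spread c []      = []
spread c (j ∷ r) = unit j c ⊕ spread c r

infixl 5 _⊙_
_⊙_ : List ℤ → SparseMatrix → List ℤ
(w ∷ ws) ⊙ (r ∷ M) = spread w r ⊕ (ws ⊙ M)
_        ⊙ _       = []

⟨⊕⟩ : ∀ ws us v → ⟨ ws ⊕ us , v ⟩ ≡ ⟨ ws , v ⟩ ℤ.+ ⟨ us , v ⟩
⟨⊕⟩ []       us       v        = sym (ℤ.+-identityˡ _)
⟨⊕⟩ (w ∷ ws) []       v        = sym (ℤ.+-identityʳ _)
⟨⊕⟩ (w ∷ ws) (u ∷ us) []       = refl
⟨⊕⟩ (w ∷ ws) (u ∷ us) (x ∷ xs) =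
  trans (cong₂ ℤ._+_ (ℤ.*-distribʳ-+ (+ x) w u) (⟨⊕⟩ ws us xs))
        (ℤ+-interchange (w ℤ.* + x) (u ℤ.* + x) ⟨ ws , xs ⟩ ⟨ us , xs ⟩)

⟨∙⟩ : ∀ c ws v → ⟨ c ∙ ws , v ⟩ ≡ c ℤ.* ⟨ ws , v ⟩
⟨∙⟩ c []       v        = sym (ℤ.*-zeroʳ c)
⟨∙⟩ c (w ∷ ws) []       = sym (ℤ.*-zeroʳ c)
⟨∙⟩ c (w ∷ ws) (x ∷ xs) = trans (cong₂ ℤ._+_ (ℤ.*-assoc c w (+ x)) (⟨∙⟩ c ws xs))
                               (sym (ℤ.*-distribˡ-+ c (w ℤ.* + x) ⟨ ws , xs ⟩))

⟨unit⟩ : ∀ j c v → ⟨ unit j c , v ⟩ ≡ c ℤ.* + (v ! j)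
⟨unit⟩ zero    c []       = sym (ℤ.*-zeroʳ c)
⟨unit⟩ (suc j) c []       = sym (ℤ.*-zeroʳ c)
⟨unit⟩ zero    c (x ∷ xs) = ℤ.+-identityʳ _
⟨unit⟩ (suc j) c (x ∷ xs) = trans (ℤ.+-identityˡ _) (⟨unit⟩ j c xs)

⟨spread⟩ : ∀ c row v → ⟨ spread c row , v ⟩ ≡ c ℤ.* + rowSum v row
⟨spread⟩ c []      v = sym (ℤ.*-zeroʳ c)
⟨spread⟩ c (j ∷ r) v = begin
  ⟨ unit j c ⊕ spread c r , v ⟩          ≡⟨ ⟨⊕⟩ (unit j c) (spread c r) v ⟩
  ⟨ unit j c , v ⟩ ℤ.+ ⟨ spread c r , v ⟩  ≡⟨ cong₂ ℤ._+_ (⟨unit⟩ j c v) (⟨spread⟩ c r v) ⟩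
  c ℤ.* + (v ! j) ℤ.+ c ℤ.* + rowSum v r  ≡⟨ sym (ℤ.*-distribˡ-+ c _ _) ⟩
  c ℤ.* (+ (v ! j) ℤ.+ + rowSum v r)      ≡⟨ cong (c ℤ.*_) (sym (ℤ.pos-+ (v ! j) (rowSum v r))) ⟩
  c ℤ.* + rowSum v (j ∷ r)                ∎

⊙-adjoint : ∀ w M v → ⟨ w ⊙ M , v ⟩ ≡ ⟨ w , M · v ⟩
⊙-adjoint []       M       v = refl
⊙-adjoint (w ∷ ws) []      v = refl
⊙-adjoint (w ∷ ws) (r ∷ M) v = begin
  ⟨ spread w r ⊕ (ws ⊙ M) , v ⟩           ≡⟨ ⟨⊕⟩ (spread w r) (ws ⊙ M) v ⟩
  ⟨ spread w r , v ⟩ ℤ.+ ⟨ ws ⊙ M , v ⟩   ≡⟨ cong₂ ℤ._+_ (⟨spread⟩ w r v) (⊙-adjoint ws M v) ⟩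
  ⟨ w ∷ ws , (r ∷ M) · v ⟩                 ∎

infix 5 _⊙_^_
_⊙_^_ : List ℤ → SparseMatrix → ℕ → List ℤ
w ⊙ M ^ zero  = w
w ⊙ M ^ suc i = (w ⊙ M) ⊙ M ^ i

Σᵥ : ℕ → (ℕ → List ℤ) → List ℤ
Σᵥ zero    U = U 0
Σᵥ (suc N) U = Σᵥ N U ⊕ U (suc N)

Σ≤-⟨⟩ : ∀ N U v → Σ≤ N (λ k → ⟨ U k , v ⟩) ≡ ⟨ Σᵥ N U , v ⟩
Σ≤-⟨⟩ zero    U v = refl
Σ≤-⟨⟩ (suc N) U v =
  trans (cong (ℤ._+ ⟨ U (suc N) , v ⟩) (Σ≤-⟨⟩ N U v)) (sym (⟨⊕⟩ (Σᵥ N U) (U (suc N)) v))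

Σ≤-cong : ∀ N {f g : ℕ → ℤ} → (∀ {k} → k ≤ N → f k ≡ g k) → Σ≤ N f ≡ Σ≤ N g
Σ≤-cong zero    eq = eq z≤n
Σ≤-cong (suc N) eq = cong₂ ℤ._+_ (Σ≤-cong N (eq ∘ m≤n⇒m≤1+n)) (eq ≤-refl)

Σ≤-tail : ∀ N m (f : ℕ → ℤ) → (∀ j → f (suc N + j) ≡ 0ℤ) → Σ≤ (N + m) f ≡ Σ≤ N f
Σ≤-tail N zero    f eq = cong (λ k → Σ≤ k f) (+-identityʳ N)
Σ≤-tail N (suc m) f eq = begin
  Σ≤ (N + suc m) f                ≡⟨ cong (λ k → Σ≤ k f) (ℕ.+-suc N m) ⟩
  Σ≤ (N + m) f ℤ.+ f (suc N + m)  ≡⟨ cong₂ ℤ._+_ (Σ≤-tail N m f eq) (eq m) ⟩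
  Σ≤ N f ℤ.+ 0ℤ                   ≡⟨ ℤ.+-identityʳ _ ⟩
  Σ≤ N f                          ∎

mulCoeff-cong : ∀ {s t : ℕ → ℤ} → (∀ k → s k ≡ t k) → ∀ p n → mulCoeff s p n ≡ mulCoeff t p n
mulCoeff-cong s≗t p n = Σ≤-cong n λ {k} _ → cong (coeff p k ℤ.*_) (s≗t (n ∸ k))

-- The weight w · p*(M) for the reversal p*(x) = xᴺ p(1/x) of a polynomial p of degree ≤ N.
reversedAction : SparseMatrix → List ℤ → ℕ → List ℤ → List ℤ
reversedAction M p N w = Σᵥ N λ k → coeff p k ∙ (w ⊙ M ^ (N ∸ k))

module WeightTransport (M : SparseMatrix) (v : ℕ → List ℕ) (v-step : ∀ n → v (suc n) ≡ M · v n) where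

  ⊙-step : ∀ w n → ⟨ w ⊙ M , v n ⟩ ≡ ⟨ w , v (suc n) ⟩
  ⊙-step w n = trans (⊙-adjoint w M (v n)) (cong ⟨ w ,_⟩ (sym (v-step n)))

  ⊙^-shift : ∀ i w n → ⟨ w ⊙ M ^ i , v n ⟩ ≡ ⟨ w , v (i + n) ⟩
  ⊙^-shift zero    w n = refl
  ⊙^-shift (suc i) w n = trans (⊙^-shift i (w ⊙ M) n) (⊙-step w (i + n))

  v-iterate : ∀ n → v n ≡ M ^ n · v 0
  v-iterate zero    = refl
  v-iterate (suc n) = trans (v-step n) (cong (M ·_) (v-iterate n))

  mulCoeff-reversedAction : ∀ p N w → (∀ j → coeff p (suc N + j) ≡ 0ℤ) → ∀ m →
    mulCoeff (λ k → ⟨ w , v k ⟩) p (N + m) ≡ ⟨ reversedAction M p N w , v m ⟩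
  mulCoeff-reversedAction p N w deg≤N m = begin
    Σ≤ (N + m) (λ k → coeff p k ℤ.* ⟨ w , v (N + m ∸ k) ⟩)
      ≡⟨ Σ≤-tail N m _ (λ j → cong (ℤ._* ⟨ w , v (N + m ∸ (suc N + j)) ⟩) (deg≤N j)) ⟩
    Σ≤ N (λ k → coeff p k ℤ.* ⟨ w , v (N + m ∸ k) ⟩)
      ≡⟨ Σ≤-cong N (λ {k} k≤N → begin
           coeff p k ℤ.* ⟨ w , v (N + m ∸ k) ⟩
             ≡⟨ cong (λ i → coeff p k ℤ.* ⟨ w , v i ⟩) (+-∸-comm m k≤N) ⟩
           coeff p k ℤ.* ⟨ w , v (N ∸ k + m) ⟩
             ≡⟨ cong (coeff p k ℤ.*_) (sym (⊙^-shift (N ∸ k) w m)) ⟩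
           coeff p k ℤ.* ⟨ w ⊙ M ^ (N ∸ k) , v m ⟩
             ≡⟨ sym (⟨∙⟩ (coeff p k) (w ⊙ M ^ (N ∸ k)) (v m)) ⟩
           ⟨ coeff p k ∙ (w ⊙ M ^ (N ∸ k)) , v m ⟩ ∎) ⟩
    Σ≤ N (λ k → ⟨ coeff p k ∙ (w ⊙ M ^ (N ∸ k)) , v m ⟩)
      ≡⟨ Σ≤-⟨⟩ N (λ k → coeff p k ∙ (w ⊙ M ^ (N ∸ k))) (v m) ⟩
    ⟨ reversedAction M p N w , v m ⟩ ∎

  eigenvector-orthogonal : ∀ {w} c → w ⊙ M ≡ c ∙ w → ⟨ w , v 0 ⟩ ≡ 0ℤ → ∀ n → ⟨ w , v n ⟩ ≡ 0ℤ
  eigenvector-orthogonal     c eig w⊥v₀ zero    = w⊥v₀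
  eigenvector-orthogonal {w} c eig w⊥v₀ (suc n) = begin
    ⟨ w , v (suc n) ⟩  ≡⟨ sym (⊙-step w n) ⟩
    ⟨ w ⊙ M , v n ⟩    ≡⟨ cong ⟨_, v n ⟩ eig ⟩
    ⟨ c ∙ w , v n ⟩    ≡⟨ ⟨∙⟩ c w (v n) ⟩
    c ℤ.* ⟨ w , v n ⟩  ≡⟨ cong (c ℤ.*_) (eigenvector-orthogonal c eig w⊥v₀ n) ⟩
    c ℤ.* 0ℤ           ≡⟨ ℤ.*-zeroʳ c ⟩
    0ℤ                 ∎

  OrbitCertificate : ℕ → ℤ → List ℤ → Set
  OrbitCertificate j c w =
    (∀ {i} → i < suc j → ⟨ w ⊙ M ^ i , v 0 ⟩ ≡ 0ℤ) × (w ⊙ M ^ j) ⊙ M ≡ c ∙ (w ⊙ M ^ j)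

  orbitCertificate? : ∀ j c w → Dec (OrbitCertificate j c w)
  orbitCertificate? j c w =
    allUpTo? (λ i → ⟨ w ⊙ M ^ i , v 0 ⟩ ℤ.≟ 0ℤ) (suc j)
    ×-dec ≡-dec ℤ._≟_ ((w ⊙ M ^ j) ⊙ M) (c ∙ (w ⊙ M ^ j))

  certificate-orthogonal : ∀ j c w → OrbitCertificate j c w → ∀ n → ⟨ w , v n ⟩ ≡ 0ℤ
  certificate-orthogonal zero    c w (⊥v₀ , eig) = eigenvector-orthogonal c eig (⊥v₀ (s≤s z≤n))
  certificate-orthogonal (suc j) c w (⊥v₀ , eig) zero    = ⊥v₀ (s≤s z≤n)
  certificate-orthogonal (suc j) c w (⊥v₀ , eig) (suc n) =
    trans (sym (⊙-step w n)) (certificate-orthogonal j c (w ⊙ M) (⊥v₀ ∘ s≤s , eig) n)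

slot : State → Fin 6 → ℕ
slot q j = toℕ q * 6 + toℕ j

block : ℕ → State → List ℕ
block n q = H n q ∷ H (1 + n) q ∷ H (2 + n) q ∷ H (3 + n) q ∷ H (4 + n) q ∷ H≤ n q ∷ []

stateVector : ℕ → List ℕ
stateVector n = concat (tabulate (block n))

stateVector-slot : ∀ n q j → stateVector n ! slot q j ≡ block n q ! toℕ j
stateVector-slot n q j = !-concat-tabulate (block n) (λ _ → refl) q (toℕ<n j)

-- The rows encode H-recurrence and H≤ (1 + n) = H (1 + n) + H≤ n.
transferRows : State → SparseMatrix
transferRows q =
  (slot q (# 1) ∷ []) ∷ (slot q (# 2) ∷ []) ∷ (slot q (# 3) ∷ []) ∷ (slot q (# 4) ∷ []) ∷
  (slot (δ q c1) (# 4) ∷ slot (δ q c2) (# 3) ∷ slot (δ q c3) (# 2) ∷ slot (δ q c4) (# 1) ∷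
   slot (δ q c5) (# 5) ∷ []) ∷
  (slot q (# 1) ∷ slot q (# 5) ∷ []) ∷ []

transfer : SparseMatrix
transfer = concat (tabulate transferRows)

block-step : ∀ n q → transferRows q · stateVector n ≡ block (suc n) q
block-step n q =
  cong₂ _∷_ (single (# 1)) (cong₂ _∷_ (single (# 2)) (cong₂ _∷_ (single (# 3)) (cong₂ _∷_ (single (# 4))
  (cong₂ _∷_ recurrence (cong (_∷ []) (cong₂ _+_ (at q (# 1)) (single (# 5))))))))
  where
  at : ∀ q j → stateVector n ! slot q j ≡ block n q ! toℕ j
  at = stateVector-slot n
  single : ∀ j → stateVector n ! slot q j + 0 ≡ block n q ! toℕ j
  single j = trans (+-identityʳ _) (at q j)
  recurrence : rowSum (stateVector n) (slot (δ q c1) (# 4) ∷ slot (δ q c2) (# 3) ∷ slot (δ q c3) (# 2) ∷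
                 slot (δ q c4) (# 1) ∷ slot (δ q c5) (# 5) ∷ []) ≡ H (5 + n) q
  recurrence = trans
    (cong₂ _+_ (at (δ q c1) (# 4)) (cong₂ _+_ (at (δ q c2) (# 3)) (cong₂ _+_ (at (δ q c3) (# 2))
    (cong₂ _+_ (at (δ q c4) (# 1)) (trans (+-identityʳ _) (at (δ q c5) (# 5)))))))
    (sym (H-recurrence n q))

stateVector-step : ∀ n → stateVector (suc n) ≡ transfer · stateVector n
stateVector-step n = begin
  concat (tabulate (block (suc n)))
    ≡⟨ cong concat (tabulate-cong (sym ∘ block-step n)) ⟩
  concat (tabulate (λ q → transferRows q · stateVector n))
    ≡⟨ cong concat (sym (map-tabulate transferRows (_· stateVector n))) ⟩
  concat (map (_· stateVector n) (tabulate transferRows))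
    ≡⟨ concat-map {f = rowSum (stateVector n)} (tabulate transferRows) ⟩
  transfer · stateVector n ∎

-- The generating function

open WeightTransport transfer stateVector stateVector-step

e₀ : List ℤ
e₀ = unit (slot start (# 0)) (+ 1)

a≡⟨e₀⟩ : ∀ n → + a n ≡ ⟨ e₀ , stateVector n ⟩
a≡⟨e₀⟩ n = begin
  + a n                                 ≡⟨ cong +_ (a≡H n) ⟩
  + (stateVector n ! 0)                 ≡⟨ sym (ℤ.*-identityˡ _) ⟩
  + 1 ℤ.* + (stateVector n ! 0)         ≡⟨ sym (⟨unit⟩ 0 (+ 1) (stateVector n)) ⟩
  ⟨ e₀ , stateVector n ⟩                ∎

initial-coefficients : ∀ {n} → n < 18 →
  mulCoeff (λ k → ⟨ e₀ , transfer ^ k · stateVector 0 ⟩) denom n ≡ - coeff numer n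
initial-coefficients = toWitness {a? = allUpTo? (λ n →
  mulCoeff (λ k → ⟨ e₀ , transfer ^ k · stateVector 0 ⟩) denom n ℤ.≟ - coeff numer n) 18} _

-- Decided by evaluation rather than by refl: the evaluator shares the intermediate vectors, while
-- the conversion checker would recompute them over and over.
annihilator-certificate : OrbitCertificate 5 (+ 2) (reversedAction transfer denom 18 e₀)
annihilator-certificate =
  toWitness {a? = orbitCertificate? 5 (+ 2) (reversedAction transfer denom 18 e₀)} _

tail-coefficients : ∀ m → mulCoeff (λ k → ⟨ e₀ , stateVector k ⟩) denom (18 + m) ≡ 0ℤ
tail-coefficients m = trans (mulCoeff-reversedAction denom 18 e₀ (λ _ → refl) m)
  (certificate-orthogonal 5 (+ 2) (reversedAction transfer denom 18 e₀) annihilator-certificate m)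

product-coefficients : ∀ n → mulCoeff (λ k → ⟨ e₀ , stateVector k ⟩) denom n ≡ - coeff numer n
product-coefficients n with n ℕ.<? 18
... | yes n<18 =
  trans (mulCoeff-cong (λ k → cong ⟨ e₀ ,_⟩ (v-iterate k)) denom n) (initial-coefficients n<18)
... | no  n≮18 = subst (λ n → mulCoeff (λ k → ⟨ e₀ , stateVector k ⟩) denom n ≡ - coeff numer n)
                       (m+[n∸m]≡n (≮⇒≥ n≮18)) (tail-coefficients (n ∸ 18))

theorem2 : (n : ℕ) → mulCoeff (λ k → + (a k)) denom n ≡ - coeff numer n
theorem2 n = trans (mulCoeff-cong a≡⟨e₀⟩ denom n) (product-coefficients n)
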